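{- Let $n=2^k+r$ with $0\le r<2^k$. The Colless index of the complete full binary tree with $n$ leaves is the minimum Colless index among all full binary trees with $n$ leaves, and it equals $\delta(n)$, the number of $D$-nodes in the divide-and-conquer tree with $n$ leaves.
   Context: A full binary tree is a rooted tree in which every node has $0$ or $2$ children. An internal node is a $D$-node if its two children have different numbers of descendant leaves. A complete full binary tree is a full binary tree in which every level except possibly the last is completely filled and all nodes of the last level are as far left as possible. A divide-and-conquer tree is a full binary tree in which, at every internal node, the numbers of leaves of the two subtrees differ by at most $1$. The Colless index of a full binary tree is $\sum|\ell_L(v)-\ell_R(v)|$ over internal nodes $v$, where $\ell_L(v),\ell_R(v)$ are the numbers of leaves in the left and right subtrees of $v$. -}

module Defs where

open import Data.Nat using (ℕ; zero; suc; _+_; _*_; _≤_; _<_; ∣_-_∣)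
open import Data.Nat.Properties using (_≟_)
open import Data.Bool using (Bool; true; false; if_then_else_)
open import Data.List using (List; []; _∷_; length; foldl)
open import Data.Product using (Σ; _×_; ∃)
open import Data.Sum using (_⊎_)
open import Data.Unit using (⊤)
open import Data.Empty using (⊥)
open import Relation.Nullary using (does)
open import Relation.Binary.PropositionalEquality using (_≡_)

data Tree : Set where
  leaf : Tree
  node : Tree → Tree → Tree

leaves : Tree → ℕ
leaves leaf = 1
leaves (node l r) = leaves l + leaves r

colless : Tree → ℕ
colless leaf = 0
colless (node l r) = ∣ leaves l - leaves r ∣ + colless l + colless r

dNodes : Tree → ℕ
dNodes leaf = 0
dNodes (node l r) =
  (if does (leaves l ≟ leaves r) then 0 else 1) + dNodes l + dNodes r

IsDivideConquer : Tree → Set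
IsDivideConquer leaf = ⊤
IsDivideConquer (node l r) =
  IsDivideConquer l × IsDivideConquer r × (∣ leaves l - leaves r ∣ ≤ 1)

HasNode : Tree → List Bool → Set
HasNode t [] = ⊤
HasNode leaf (b ∷ p) = ⊥
HasNode (node l r) (false ∷ p) = HasNode l p
HasNode (node l r) (true ∷ p) = HasNode r p

bit : Bool → ℕ
bit false = 0
bit true = 1

-- left-to-right index of a position within its level (path read as a binary
-- number, most significant bit first, left = 0)
pos : List Bool → ℕ
pos p = foldl (λ a b → 2 * a + bit b) 0 p

-- Complete full binary tree: for some height h, all levels of depth < h are
-- completely filled, and the nodes at depth h are exactly the m leftmost
-- positions of that level (for some m); there are no nodes below depth h.
IsComplete : Tree → Set
IsComplete t =
  Σ ℕ λ h → Σ ℕ λ m → (p : List Bool) →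
    (HasNode t p → (length p < h ⊎ (length p ≡ h × pos p < m)))
    × ((length p < h ⊎ (length p ≡ h × pos p < m)) → HasNode t p)

{-# OPTIONS --safe #-}
module Submission where

-- Let f be given by the divide-and-conquer recurrence f(n) = f⌊n/2⌋ + f⌈n/2⌉ + (n mod 2),
-- f(1) = 0.  By strong induction on a + b and a case analysis on the parities of a and b,
-- f(a + b) ≤ |a - b| + f(a) + f(b) for all a, b; applied at every internal node this gives
-- f(leaves t) ≤ colless t for every tree t.  The inequality is an equality when |a - b| ≤ 1,
-- so a divide-and-conquer tree with n leaves has f(n) D-nodes; and it is an equality when
-- a = 2^j and 2^(j-1) ≤ b ≤ 2^(j+1), which is the split at every node of a complete tree,
-- so a complete tree with n leaves has Colless index f(n).

open import Defs
open import Data.Bool using (Bool; true; false; if_then_else_)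
open import Data.Empty using (⊥-elim)
open import Data.List using (List; []; _∷_; length; foldl)
open import Data.Nat
open import Data.Nat.Induction using (<-rec)
open import Data.Nat.Properties
open import Data.Nat.Tactic.RingSolver using (solve; solve-∀)
open import Data.Product as Product using (Σ; _,_; _×_; ∃-syntax; proj₁; proj₂)
open import Data.Sum as Sum using (_⊎_; inj₁; inj₂)
open import Data.Unit using (tt)
open import Function using (_∘_)
open import Function.Bundles using (_⇔_; mk⇔; Equivalence)
open import Function.Construct.Composition using (_⇔-∘_)
open import Function.Construct.Symmetry using (⇔-sym)
open import Relation.Nullary using (Dec; yes; no; does)
open import Relation.Binary.PropositionalEquality

m+k≡n⇒m≤n : ∀ {m n} k → m + k ≡ n → m ≤ n
m+k≡n⇒m≤n {m} k refl = m≤m+n m k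

2*m≤1+2*n⇒m≤n : ∀ {m n} → 2 * m ≤ 1 + 2 * n → m ≤ n
2*m≤1+2*n⇒m≤n {m} {n} h = ≮⇒≥ λ n<m → <⇒≱ (subst (_≤ 2 * m) (*-suc 2 n) (*-monoʳ-≤ 2 n<m)) h

⌊2*n/2⌋≡n : ∀ n → ⌊ 2 * n /2⌋ ≡ n
⌊2*n/2⌋≡n n = sym (trans (n≡⌊n+n/2⌋ n) (cong (λ m → ⌊ n + m /2⌋) (sym (+-identityʳ n))))

⌈2*n/2⌉≡n : ∀ n → ⌈ 2 * n /2⌉ ≡ n
⌈2*n/2⌉≡n n = sym (trans (n≡⌈n+n/2⌉ n) (cong (λ m → ⌈ n + m /2⌉) (sym (+-identityʳ n))))

+-<⇔<-∸ : ∀ a b m → a + b < m ⇔ b < m ∸ a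
+-<⇔<-∸ a b m = mk⇔
  (λ a+b<m → m+n≤o⇒m≤o∸n (suc b) (subst (_≤ m) (cong suc (+-comm a b)) a+b<m))
  (λ b<m∸a → subst (_≤ m) (cong suc (+-comm b a))
                   (m≤o∸n⇒m+n≤o (suc b) (<⇒≤ (m∸n≢0⇒n<m (m<n⇒n≢0 b<m∸a))) b<m∸a))

⊓-∸-split : ∀ m c → m ⊓ c + (m ∸ c) ⊓ c ≡ m ⊓ (2 * c)
⊓-∸-split m c with m ≤? c
... | yes m≤c = begin
  m ⊓ c + (m ∸ c) ⊓ c ≡⟨ cong₂ (λ x y → x + y ⊓ c) (m≤n⇒m⊓n≡m m≤c) (m≤n⇒m∸n≡0 m≤c) ⟩
  m + 0               ≡⟨ +-identityʳ m ⟩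
  m                   ≡⟨ m≤n⇒m⊓n≡m (≤-trans m≤c (m≤m+n c _)) ⟨
  m ⊓ (2 * c)         ∎
  where open ≡-Reasoning
... | no m≰c = begin
  m ⊓ c + (m ∸ c) ⊓ c         ≡⟨ cong (_+ (m ∸ c) ⊓ c) (m≥n⇒m⊓n≡n c≤m) ⟩
  c + (m ∸ c) ⊓ c             ≡⟨ +-distribˡ-⊓ c (m ∸ c) c ⟩
  (c + (m ∸ c)) ⊓ (c + c)     ≡⟨ cong₂ _⊓_ (m+[n∸m]≡n c≤m) (cong (c +_) (sym (+-identityʳ c))) ⟩
  m ⊓ (2 * c)                 ∎
  where
  open ≡-Reasoning
  c≤m : c ≤ m
  c≤m = <⇒≤ (≰⇒> m≰c)

∣m-n∣+∣m-1+n∣≡∣2*m-1+2*n∣ : ∀ m n → ∣ m - n ∣ + ∣ m - suc n ∣ ≡ ∣ 2 * m - suc (2 * n) ∣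
∣m-n∣+∣m-1+n∣≡∣2*m-1+2*n∣ zero    n       =
  trans (+-suc n n) (cong (suc ∘ (n +_)) (sym (+-identityʳ n)))
∣m-n∣+∣m-1+n∣≡∣2*m-1+2*n∣ (suc m) zero
  rewrite ∣-∣-identityʳ m | +-suc m (m + 0) | +-identityʳ m = refl
∣m-n∣+∣m-1+n∣≡∣2*m-1+2*n∣ (suc m) (suc n)
  rewrite +-suc m (m + 0) | +-suc n (n + 0) = ∣m-n∣+∣m-1+n∣≡∣2*m-1+2*n∣ m n

∣1+m-n∣≤1+∣m-n∣ : ∀ m n → ∣ suc m - n ∣ ≤ suc ∣ m - n ∣
∣1+m-n∣≤1+∣m-n∣ zero    zero    = ≤-refl
∣1+m-n∣≤1+∣m-n∣ zero    (suc n) = m≤n+m n 2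
∣1+m-n∣≤1+∣m-n∣ (suc m) zero    = ≤-refl
∣1+m-n∣≤1+∣m-n∣ (suc m) (suc n) = ∣1+m-n∣≤1+∣m-n∣ m n

∣m-n∣≤1⇒adjacent : ∀ m n → ∣ m - n ∣ ≤ 1 → m ≡ n ⊎ m ≡ suc n ⊎ n ≡ suc m
∣m-n∣≤1⇒adjacent zero          zero          _ = inj₁ refl
∣m-n∣≤1⇒adjacent zero          (suc zero)    _ = inj₂ (inj₂ refl)
∣m-n∣≤1⇒adjacent (suc zero)    zero          _ = inj₂ (inj₁ refl)
∣m-n∣≤1⇒adjacent (suc m)       (suc n)       h =
  Sum.map (cong suc) (Sum.map (cong suc) (cong suc)) (∣m-n∣≤1⇒adjacent m n h)
∣m-n∣≤1⇒adjacent zero          (suc (suc _)) (s≤s ())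
∣m-n∣≤1⇒adjacent (suc (suc _)) zero          (s≤s ())

m≤n⇒∣m-n∣≤1⇒∣1+m-n∣≤1 : ∀ {m n} → m ≤ n → ∣ m - n ∣ ≤ 1 → ∣ suc m - n ∣ ≤ 1
m≤n⇒∣m-n∣≤1⇒∣1+m-n∣≤1 {zero}  {zero}        _         _        = ≤-refl
m≤n⇒∣m-n∣≤1⇒∣1+m-n∣≤1 {zero}  {suc zero}    _         _        = z≤n
m≤n⇒∣m-n∣≤1⇒∣1+m-n∣≤1 {zero}  {suc (suc _)} _         (s≤s ())
m≤n⇒∣m-n∣≤1⇒∣1+m-n∣≤1 {suc _} {suc _}       (s≤s m≤n) h        = m≤n⇒∣m-n∣≤1⇒∣1+m-n∣≤1 m≤n h

data ParityView : ℕ → Set where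
  even : ∀ m → ParityView (2 * m)
  odd  : ∀ m → ParityView (1 + 2 * m)

parityView : ∀ n → ParityView n
parityView zero    = even 0
parityView (suc n) with parityView n
... | even m = odd m
... | odd m  = subst ParityView (*-suc 2 m) (even (suc m))

-- The recurrence

-- minColless′ n k unfolds the recurrence at most k times; any fuel k ≥ n gives the same value.
minColless′ : ℕ → ℕ → ℕ
minColless′ (suc (suc n)) (suc k) =
  minColless′ (suc ⌊ n /2⌋) k + minColless′ (suc ⌈ n /2⌉) k + (⌈ n /2⌉ ∸ ⌊ n /2⌋)
minColless′ _             _       = 0

minColless : ℕ → ℕ
minColless n = minColless′ n n

minColless′-fuel : ∀ n {j k} → n ≤ j → n ≤ k → minColless′ n j ≡ minColless′ n k
minColless′-fuel zero                _         _         = refl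
minColless′-fuel (suc zero)          _         _         = refl
minColless′-fuel (suc (suc n)) {suc j} {suc k} (s≤s n<j) (s≤s n<k) =
  cong₂ (λ x y → x + y + (⌈ n /2⌉ ∸ ⌊ n /2⌋))
    (minColless′-fuel _ (⌊≤ n<j) (⌊≤ n<k)) (minColless′-fuel _ (⌈≤ n<j) (⌈≤ n<k))
  where
  ⌊≤ : ∀ {k} → suc n ≤ k → suc ⌊ n /2⌋ ≤ k
  ⌊≤ = ≤-trans (s≤s (⌊n/2⌋≤n n))
  ⌈≤ : ∀ {k} → suc n ≤ k → suc ⌈ n /2⌉ ≤ k
  ⌈≤ = ≤-trans (s≤s (⌈n/2⌉≤n n))

minColless-halves : ∀ n → minColless (2 + n) ≡
  minColless (suc ⌊ n /2⌋) + minColless (suc ⌈ n /2⌉) + (⌈ n /2⌉ ∸ ⌊ n /2⌋)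
minColless-halves n = cong₂ (λ x y → x + y + (⌈ n /2⌉ ∸ ⌊ n /2⌋))
  (minColless′-fuel _ (s≤s (⌊n/2⌋≤n n)) ≤-refl)
  (minColless′-fuel _ (s≤s (⌈n/2⌉≤n n)) ≤-refl)

minColless-double : ∀ m → minColless (2 * m) ≡ 2 * minColless m
minColless-double zero    = refl
minColless-double (suc m) = begin
  minColless (2 * suc m)                   ≡⟨ cong minColless (*-suc 2 m) ⟩
  minColless (2 + 2 * m)                   ≡⟨ minColless-halves (2 * m) ⟩
  minColless (suc ⌊ 2 * m /2⌋) + minColless (suc ⌈ 2 * m /2⌉) + (⌈ 2 * m /2⌉ ∸ ⌊ 2 * m /2⌋)
    ≡⟨ cong₂ (λ x y → minColless (suc x) + minColless (suc y) + (y ∸ x)) (⌊2*n/2⌋≡n m) (⌈2*n/2⌉≡n m) ⟩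
  minColless (suc m) + minColless (suc m) + (m ∸ m)
    ≡⟨ cong (minColless (suc m) + minColless (suc m) +_) (n∸n≡0 m) ⟩
  minColless (suc m) + minColless (suc m) + 0 ≡⟨ +-assoc (minColless (suc m)) _ 0 ⟩
  2 * minColless (suc m)                   ∎
  where open ≡-Reasoning

minColless-odd : ∀ m → .{{NonZero m}} → minColless (1 + 2 * m) ≡ minColless m + minColless (1 + m) + 1
minColless-odd (suc m) = begin
  minColless (1 + 2 * suc m)               ≡⟨ cong (minColless ∘ suc) (*-suc 2 m) ⟩
  minColless (2 + suc (2 * m))             ≡⟨ minColless-halves (suc (2 * m)) ⟩
  minColless (suc ⌈ 2 * m /2⌉) + minColless (2 + ⌊ 2 * m /2⌋) + (suc ⌊ 2 * m /2⌋ ∸ ⌈ 2 * m /2⌉)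
    ≡⟨ cong₂ (λ x y → minColless (suc y) + minColless (2 + x) + (suc x ∸ y))
             (⌊2*n/2⌋≡n m) (⌈2*n/2⌉≡n m) ⟩
  minColless (suc m) + minColless (2 + m) + (1 + m ∸ m)
    ≡⟨ cong (minColless (suc m) + minColless (2 + m) +_) (m+n∸n≡m 1 m) ⟩
  minColless (suc m) + minColless (2 + m) + 1 ∎
  where open ≡-Reasoning

minColless-even+odd : ∀ p q → .{{NonZero (p + q)}} →
  minColless (2 * p + (1 + 2 * q)) ≡ minColless (p + q) + minColless (p + suc q) + 1
minColless-even+odd p q = begin
  minColless (2 * p + (1 + 2 * q))   ≡⟨ cong minColless (regroup p q) ⟩
  minColless (1 + 2 * (p + q))       ≡⟨ minColless-odd (p + q) ⟩
  minColless (p + q) + minColless (1 + (p + q)) + 1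
    ≡⟨ cong (λ x → minColless (p + q) + minColless x + 1) (+-suc p q) ⟨
  minColless (p + q) + minColless (p + suc q) + 1 ∎
  where
  open ≡-Reasoning
  regroup : ∀ p q → 2 * p + (1 + 2 * q) ≡ 1 + 2 * (p + q)
  regroup = solve-∀

minColless-2^ : ∀ j → minColless (2 ^ j) ≡ 0
minColless-2^ zero    = refl
minColless-2^ (suc j) = trans (minColless-double (2 ^ j)) (cong (2 *_) (minColless-2^ j))

splitCost : ℕ → ℕ → ℕ
splitCost a b = ∣ a - b ∣ + minColless a + minColless b

splitCost-comm : ∀ a b → splitCost a b ≡ splitCost b a
splitCost-comm a b = begin
  ∣ a - b ∣ + minColless a + minColless b
    ≡⟨ cong (λ d → d + minColless a + minColless b) (∣-∣-comm a b) ⟩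
  ∣ b - a ∣ + minColless a + minColless b   ≡⟨ +-assoc ∣ b - a ∣ (minColless a) _ ⟩
  ∣ b - a ∣ + (minColless a + minColless b) ≡⟨ cong (∣ b - a ∣ +_) (+-comm (minColless a) _) ⟩
  ∣ b - a ∣ + (minColless b + minColless a) ≡⟨ +-assoc ∣ b - a ∣ (minColless b) _ ⟨
  ∣ b - a ∣ + minColless b + minColless a   ∎
  where open ≡-Reasoning

splitCost-double : ∀ p q → splitCost (2 * p) (2 * q) ≡ 2 * splitCost p q
splitCost-double p q = begin
  ∣ 2 * p - 2 * q ∣ + minColless (2 * p) + minColless (2 * q)
    ≡⟨ cong₂ _+_ (cong₂ _+_ (sym (*-distribˡ-∣-∣ 2 p q)) (minColless-double p)) (minColless-double q) ⟩
  2 * ∣ p - q ∣ + 2 * minColless p + 2 * minColless q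
    ≡⟨ regroup ∣ p - q ∣ (minColless p) (minColless q) ⟩
  2 * splitCost p q ∎
  where
  open ≡-Reasoning
  regroup : ∀ d x y → 2 * d + 2 * x + 2 * y ≡ 2 * (d + x + y)
  regroup = solve-∀

splitCost-even-odd : ∀ p q → .{{NonZero q}} →
  splitCost p q + splitCost p (suc q) + 1 ≡ splitCost (2 * p) (1 + 2 * q)
splitCost-even-odd p q = begin
  splitCost p q + splitCost p (suc q) + 1
    ≡⟨ regroup ∣ p - q ∣ ∣ p - suc q ∣ (minColless p) (minColless q) (minColless (suc q)) ⟩
  (∣ p - q ∣ + ∣ p - suc q ∣) + 2 * minColless p + (minColless q + minColless (suc q) + 1)
    ≡⟨ cong₂ _+_ (cong₂ _+_ (∣m-n∣+∣m-1+n∣≡∣2*m-1+2*n∣ p q) (sym (minColless-double p)))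
                 (sym (minColless-odd q)) ⟩
  splitCost (2 * p) (1 + 2 * q) ∎
  where
  open ≡-Reasoning
  regroup : ∀ d d′ x y z → (d + x + y) + (d′ + x + z) + 1 ≡ (d + d′) + 2 * x + (y + z + 1)
  regroup = solve-∀

splitCost-odd-odd : ∀ p q → .{{NonZero p}} → .{{NonZero q}} →
  splitCost (suc p) q + splitCost p (suc q) ≤ splitCost (1 + 2 * p) (1 + 2 * q)
splitCost-odd-odd p q = begin
  splitCost (suc p) q + splitCost p (suc q)
    ≡⟨ regroup ∣ suc p - q ∣ ∣ p - suc q ∣ (minColless p) (minColless (suc p))
               (minColless q) (minColless (suc q)) ⟩
  (∣ suc p - q ∣ + ∣ p - suc q ∣) + (minColless p + minColless (suc p))
    + (minColless q + minColless (suc q))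
    ≤⟨ +-monoˡ-≤ _ (+-monoˡ-≤ _ (+-mono-≤ (∣1+m-n∣≤1+∣m-n∣ p q) ∣p-1+q∣≤1+∣p-q∣)) ⟩
  (suc ∣ p - q ∣ + suc ∣ p - q ∣) + (minColless p + minColless (suc p))
    + (minColless q + minColless (suc q))
    ≡⟨ regroup′ ∣ p - q ∣ (minColless p) (minColless (suc p)) (minColless q) (minColless (suc q)) ⟩
  2 * ∣ p - q ∣ + (minColless p + minColless (suc p) + 1) + (minColless q + minColless (suc q) + 1)
    ≡⟨ cong₂ _+_ (cong₂ _+_ (*-distribˡ-∣-∣ 2 p q) (sym (minColless-odd p))) (sym (minColless-odd q)) ⟩
  splitCost (1 + 2 * p) (1 + 2 * q) ∎
  where
  open ≤-Reasoning
  ∣p-1+q∣≤1+∣p-q∣ : ∣ p - suc q ∣ ≤ suc ∣ p - q ∣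
  ∣p-1+q∣≤1+∣p-q∣ =
    subst₂ (λ x y → x ≤ suc y) (∣-∣-comm (suc q) p) (∣-∣-comm q p) (∣1+m-n∣≤1+∣m-n∣ q p)
  regroup : ∀ d d′ x x′ y y′ → (d + x′ + y) + (d′ + x + y′) ≡ (d + d′) + (x + x′) + (y + y′)
  regroup = solve-∀
  regroup′ : ∀ d x x′ y y′ →
             (suc d + suc d) + (x + x′) + (y + y′) ≡ 2 * d + (x + x′ + 1) + (y + y′ + 1)
  regroup′ = solve-∀

splitCost-even-one : ∀ p → .{{NonZero p}} → minColless p + splitCost p 1 + 1 ≤ splitCost (2 * p) 1
splitCost-even-one p@(suc p′) = begin
  minColless p + splitCost p 1 + 1
    ≡⟨ cong (λ d → minColless p + (d + minColless p + 0) + 1) (∣-∣-identityʳ p′) ⟩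
  minColless p + (p′ + minColless p + 0) + 1        ≤⟨ m+k≡n⇒m≤n p′ (regroup p′ (minColless p)) ⟩
  p′ + suc (p′ + 0) + 2 * minColless p + 0
    ≡⟨ cong (λ d → d + 2 * minColless p + 0) (∣-∣-identityʳ (p′ + suc (p′ + 0))) ⟨
  ∣ 2 * p - 1 ∣ + 2 * minColless p + 0
    ≡⟨ cong (λ x → ∣ 2 * p - 1 ∣ + x + 0) (minColless-double p) ⟨
  splitCost (2 * p) 1                               ∎
  where
  open ≤-Reasoning
  regroup : ∀ p′ x → x + (p′ + x + 0) + 1 + p′ ≡ p′ + suc (p′ + 0) + 2 * x + 0
  regroup = solve-∀

splitCost-one-odd : ∀ q → .{{NonZero q}} → minColless (suc q) + splitCost 1 q ≤ splitCost 1 (1 + 2 * q)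
splitCost-one-odd q@(suc q′) = begin
  minColless (suc q) + (q′ + 0 + minColless q)
    ≤⟨ m+k≡n⇒m≤n (q′ + 3) (regroup q′ (minColless q) (minColless (suc q))) ⟩
  2 * q + 0 + (minColless q + minColless (suc q) + 1) ≡⟨ cong (2 * q + 0 +_) (minColless-odd q) ⟨
  splitCost 1 (1 + 2 * q)                             ∎
  where
  open ≤-Reasoning
  regroup : ∀ q′ x y → y + (q′ + 0 + x) + (q′ + 3) ≡ 2 * suc q′ + 0 + (x + y + 1)
  regroup = solve-∀

-- The split bound

SplitBoundBelow : ℕ → Set
SplitBoundBelow n = ∀ a b → a + b < n → minColless (a + b) ≤ splitCost a b

SplitBoundBelow-comm : ∀ a b → SplitBoundBelow (a + b) → SplitBoundBelow (b + a)
SplitBoundBelow-comm a b ih a′ b′ lt = ih a′ b′ (subst (a′ + b′ <_) (+-comm b a) lt)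

split-comm : ∀ a b → minColless (b + a) ≤ splitCost b a → minColless (a + b) ≤ splitCost a b
split-comm a b = subst₂ _≤_ (cong minColless (+-comm b a)) (splitCost-comm b a)

split-zeroˡ : ∀ b → minColless (0 + b) ≤ splitCost 0 b
split-zeroˡ b = m≤n+m (minColless b) (b + 0)

split-even-even : ∀ p q → .{{NonZero p}} → SplitBoundBelow (2 * p + 2 * q) →
                  minColless (2 * p + 2 * q) ≤ splitCost (2 * p) (2 * q)
split-even-even p@(suc p′) q ih = begin
  minColless (2 * p + 2 * q) ≡⟨ cong minColless (*-distribˡ-+ 2 p q) ⟨
  minColless (2 * (p + q))   ≡⟨ minColless-double (p + q) ⟩
  2 * minColless (p + q)     ≤⟨ *-monoʳ-≤ 2 (ih p q (m+k≡n⇒m≤n (p′ + q) (solve (p′ ∷ q ∷ [])))) ⟩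
  2 * splitCost p q          ≡⟨ splitCost-double p q ⟨
  splitCost (2 * p) (2 * q)  ∎
  where open ≤-Reasoning

split-even-odd : ∀ p q → .{{NonZero q}} → SplitBoundBelow (2 * p + (1 + 2 * q)) →
                 minColless (2 * p + (1 + 2 * q)) ≤ splitCost (2 * p) (1 + 2 * q)
split-even-odd p q@(suc q′) ih = begin
  minColless (2 * p + (1 + 2 * q))     ≡⟨ minColless-even+odd p q {{p+q≢0}} ⟩
  minColless (p + q) + minColless (p + suc q) + 1
    ≤⟨ +-monoˡ-≤ 1 (+-mono-≤ (ih p q (m+k≡n⇒m≤n (suc (p + q′)) (regroup p q′)))
                              (ih p (suc q) (m+k≡n⇒m≤n (p + q′) (regroup′ p q′)))) ⟩
  splitCost p q + splitCost p (suc q) + 1 ≡⟨ splitCost-even-odd p q ⟩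
  splitCost (2 * p) (1 + 2 * q)        ∎
  where
  open ≤-Reasoning
  p+q≢0 : NonZero (p + q)
  p+q≢0 = >-nonZero (<-≤-trans z<s (m≤n+m q p))
  regroup : ∀ p q′ → suc (p + suc q′) + suc (p + q′) ≡ 2 * p + (1 + 2 * suc q′)
  regroup = solve-∀
  regroup′ : ∀ p q′ → suc (p + suc (suc q′)) + (p + q′) ≡ 2 * p + (1 + 2 * suc q′)
  regroup′ = solve-∀

split-even-one : ∀ p → .{{NonZero p}} → SplitBoundBelow (2 * p + 1) →
                 minColless (2 * p + 1) ≤ splitCost (2 * p) 1
split-even-one p@(suc p′) ih = begin
  minColless (2 * p + 1)                 ≡⟨ cong minColless (+-comm (2 * p) 1) ⟩
  minColless (1 + 2 * p)                 ≡⟨ minColless-odd p ⟩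
  minColless p + minColless (1 + p) + 1  ≡⟨ cong (λ x → minColless p + minColless x + 1) (+-comm 1 p) ⟩
  minColless p + minColless (p + 1) + 1
    ≤⟨ +-monoˡ-≤ 1 (+-monoʳ-≤ (minColless p) (ih p 1 (m+k≡n⇒m≤n p′ (regroup p′)))) ⟩
  minColless p + splitCost p 1 + 1       ≤⟨ splitCost-even-one p ⟩
  splitCost (2 * p) 1                    ∎
  where
  open ≤-Reasoning
  regroup : ∀ p′ → suc (suc p′ + 1) + p′ ≡ 2 * suc p′ + 1
  regroup = solve-∀

split-one-odd : ∀ q → .{{NonZero q}} → SplitBoundBelow (1 + (1 + 2 * q)) →
                minColless (1 + (1 + 2 * q)) ≤ splitCost 1 (1 + 2 * q)
split-one-odd q ih = begin
  minColless (1 + (1 + 2 * q))            ≡⟨ cong minColless (*-suc 2 q) ⟨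
  minColless (2 * suc q)                  ≡⟨ minColless-double (suc q) ⟩
  2 * minColless (suc q)                  ≡⟨ cong (minColless (suc q) +_) (+-identityʳ _) ⟩
  minColless (suc q) + minColless (suc q)
    ≤⟨ +-monoʳ-≤ (minColless (suc q)) (ih 1 q (m+k≡n⇒m≤n q (regroup q))) ⟩
  minColless (suc q) + splitCost 1 q      ≤⟨ splitCost-one-odd q ⟩
  splitCost 1 (1 + 2 * q)                 ∎
  where
  open ≤-Reasoning
  regroup : ∀ q → suc (1 + q) + q ≡ 1 + (1 + 2 * q)
  regroup = solve-∀

split-odd-odd : ∀ p q → .{{NonZero p}} → .{{NonZero q}} → SplitBoundBelow ((1 + 2 * p) + (1 + 2 * q)) →
                minColless ((1 + 2 * p) + (1 + 2 * q)) ≤ splitCost (1 + 2 * p) (1 + 2 * q)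
split-odd-odd p q ih = begin
  minColless ((1 + 2 * p) + (1 + 2 * q))   ≡⟨ cong minColless (regroup p q) ⟩
  minColless (2 * suc (p + q))             ≡⟨ minColless-double (suc (p + q)) ⟩
  2 * minColless (suc (p + q))
    ≡⟨ cong₂ _+_ refl (trans (+-identityʳ _) (cong minColless (sym (+-suc p q)))) ⟩
  minColless (suc p + q) + minColless (p + suc q)
    ≤⟨ +-mono-≤ (ih (suc p) q (m+k≡n⇒m≤n (p + q) (regroup′ p q)))
                (ih p (suc q) (m+k≡n⇒m≤n (p + q) (regroup″ p q))) ⟩
  splitCost (suc p) q + splitCost p (suc q) ≤⟨ splitCost-odd-odd p q ⟩
  splitCost (1 + 2 * p) (1 + 2 * q)        ∎
  where
  open ≤-Reasoning
  regroup : ∀ p q → (1 + 2 * p) + (1 + 2 * q) ≡ 2 * suc (p + q)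
  regroup = solve-∀
  regroup′ : ∀ p q → suc (suc p + q) + (p + q) ≡ (1 + 2 * p) + (1 + 2 * q)
  regroup′ = solve-∀
  regroup″ : ∀ p q → suc (p + suc q) + (p + q) ≡ (1 + 2 * p) + (1 + 2 * q)
  regroup″ = solve-∀

-- The odd recurrence needs a positive half, so parts equal to 0 or 1 are treated separately.
split-by-parity : ∀ {a b} → ParityView a → ParityView b → SplitBoundBelow (a + b) →
                  minColless (a + b) ≤ splitCost a b
split-by-parity {b = b} (even zero)    _              _  = split-zeroˡ b
split-by-parity {a = a} _              (even zero)    _  = split-comm a 0 (split-zeroˡ a)
split-by-parity         (even (suc p)) (even q)       ih = split-even-even (suc p) q ih
split-by-parity         (even (suc p)) (odd zero)     ih = split-even-one (suc p) ih
split-by-parity         (even p)       (odd (suc q))  ih = split-even-odd p (suc q) ih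
split-by-parity         (odd zero)     (even (suc q)) ih =
  split-comm 1 (2 * suc q) (split-even-one (suc q) (SplitBoundBelow-comm 1 (2 * suc q) ih))
split-by-parity         (odd (suc p))  (even (suc q)) ih =
  split-comm (1 + 2 * suc p) (2 * suc q)
    (split-even-odd (suc q) (suc p) (SplitBoundBelow-comm (1 + 2 * suc p) (2 * suc q) ih))
split-by-parity         (odd zero)     (odd zero)     _  = z≤n
split-by-parity         (odd zero)     (odd (suc q))  ih = split-one-odd (suc q) ih
split-by-parity         (odd (suc p))  (odd zero)     ih =
  split-comm (1 + 2 * suc p) 1 (split-one-odd (suc p) (SplitBoundBelow-comm (1 + 2 * suc p) 1 ih))
split-by-parity         (odd (suc p))  (odd (suc q))  ih = split-odd-odd (suc p) (suc q) ih

minColless-≤-splitCost : ∀ a b → minColless (a + b) ≤ splitCost a b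
minColless-≤-splitCost a b = <-rec SplitBound step (a + b) a b refl
  where
  SplitBound : ℕ → Set
  SplitBound n = ∀ a b → a + b ≡ n → minColless (a + b) ≤ splitCost a b
  step : ∀ n → (∀ {m} → m < n → SplitBound m) → SplitBound n
  step _ rec a b refl = split-by-parity (parityView a) (parityView b) (λ a′ b′ lt → rec lt a′ b′ refl)

minColless-n+1+n : ∀ n → .{{NonZero n}} → minColless (n + suc n) ≡ splitCost n (suc n)
minColless-n+1+n n = begin
  minColless (n + suc n)                  ≡⟨ cong minColless (regroup n) ⟩
  minColless (1 + 2 * n)                  ≡⟨ minColless-odd n ⟩
  minColless n + minColless (1 + n) + 1   ≡⟨ regroup′ (minColless n) (minColless (1 + n)) ⟩
  1 + minColless n + minColless (1 + n)
    ≡⟨ cong (λ d → d + minColless n + minColless (1 + n)) ∣n-1+n∣≡1 ⟨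
  splitCost n (suc n)                     ∎
  where
  open ≡-Reasoning
  ∣n-1+n∣≡1 : ∣ n - suc n ∣ ≡ 1
  ∣n-1+n∣≡1 = trans (cong ∣ n -_∣ (+-comm 1 n)) (∣m-m+n∣≡n n 1)
  regroup : ∀ n → n + suc n ≡ 1 + 2 * n
  regroup = solve-∀
  regroup′ : ∀ x y → x + y + 1 ≡ 1 + x + y
  regroup′ = solve-∀

minColless-balanced : ∀ a b → .{{NonZero a}} → .{{NonZero b}} → ∣ a - b ∣ ≤ 1 →
                      minColless (a + b) ≡ splitCost a b
minColless-balanced a b ∣a-b∣≤1 with ∣m-n∣≤1⇒adjacent a b ∣a-b∣≤1
... | inj₁ refl = begin
  minColless (a + a)           ≡⟨ cong minColless (cong (a +_) (+-identityʳ a)) ⟨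
  minColless (2 * a)           ≡⟨ minColless-double a ⟩
  2 * minColless a             ≡⟨ cong (minColless a +_) (+-identityʳ _) ⟩
  minColless a + minColless a  ≡⟨ cong (λ d → d + minColless a + minColless a) (∣n-n∣≡0 a) ⟨
  splitCost a a                ∎
  where open ≡-Reasoning
... | inj₂ (inj₂ refl) = minColless-n+1+n a
... | inj₂ (inj₁ refl) = begin
  minColless (suc b + b)   ≡⟨ cong minColless (+-comm (suc b) b) ⟩
  minColless (b + suc b)   ≡⟨ minColless-n+1+n b ⟩
  splitCost b (suc b)      ≡⟨ splitCost-comm b (suc b) ⟩
  splitCost (suc b) b      ∎
  where open ≡-Reasoning

-- Stated with 1 + 2 * x rather than 2 * x so that the hypothesis passes to the halves of x
-- without a parity argument.
minColless-2^+ : ∀ j x → .{{NonZero x}} → 2 ^ j ≤ 1 + 2 * x → x ≤ 2 * 2 ^ j →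
                 minColless (2 ^ j + x) ≡ splitCost (2 ^ j) x
minColless-2^+ zero    1                   _ _ = refl
minColless-2^+ zero    2                   _ _ = refl
minColless-2^+ zero    (suc (suc (suc _))) _ (s≤s (s≤s ()))
minColless-2^+ (suc j) x c≤1+2x x≤2c with parityView x
... | even zero    = ⊥-elim (≢-nonZero⁻¹ 0 refl)
... | even (suc y) = begin
  minColless (2 * d + 2 * suc y)   ≡⟨ cong minColless (*-distribˡ-+ 2 d (suc y)) ⟨
  minColless (2 * (d + suc y))     ≡⟨ minColless-double (d + suc y) ⟩
  2 * minColless (d + suc y)       ≡⟨ cong (2 *_) (minColless-2^+ j (suc y) d≤1+2y y≤2d) ⟩
  2 * splitCost d (suc y)          ≡⟨ splitCost-double d (suc y) ⟨
  splitCost (2 * d) (2 * suc y)    ∎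
  where
  open ≡-Reasoning
  d = 2 ^ j
  d≤1+2y : d ≤ 1 + 2 * suc y
  d≤1+2y = m≤n⇒m≤1+n (2*m≤1+2*n⇒m≤n c≤1+2x)
  y≤2d : suc y ≤ 2 * d
  y≤2d = *-cancelˡ-≤ 2 x≤2c
... | odd zero rewrite ≤-antisym (2*m≤1+2*n⇒m≤n c≤1+2x) (m^n>0 2 j) = refl
... | odd (suc y) = begin
  minColless (2 * d + (1 + 2 * suc y))                     ≡⟨ minColless-even+odd d (suc y) {{d+y≢0}} ⟩
  minColless (d + suc y) + minColless (d + suc (suc y)) + 1
    ≡⟨ cong₂ (λ u v → u + v + 1) (minColless-2^+ j (suc y) d≤1+2y (<⇒≤ y<2d))
                                 (minColless-2^+ j (suc (suc y)) d≤3+2y y<2d) ⟩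
  splitCost d (suc y) + splitCost d (suc (suc y)) + 1     ≡⟨ splitCost-even-odd d (suc y) ⟩
  splitCost (2 * d) (1 + 2 * suc y)                        ∎
  where
  open ≡-Reasoning
  d = 2 ^ j
  d+y≢0 : NonZero (d + suc y)
  d+y≢0 = >-nonZero (<-≤-trans (m^n>0 2 j) (m≤m+n d (suc y)))
  d≤1+2y : d ≤ 1 + 2 * suc y
  d≤1+2y = 2*m≤1+2*n⇒m≤n c≤1+2x
  d≤3+2y : d ≤ 1 + 2 * suc (suc y)
  d≤3+2y = ≤-trans d≤1+2y (s≤s (*-monoʳ-≤ 2 (n≤1+n (suc y))))
  y<2d : suc y < 2 * d
  y<2d = *-cancelˡ-< 2 _ _ x≤2c

leaves>0 : ∀ t → 0 < leaves t
leaves>0 leaf       = z<s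
leaves>0 (node l r) = <-≤-trans (leaves>0 l) (m≤m+n (leaves l) (leaves r))

leaves-nonZero : ∀ t → NonZero (leaves t)
leaves-nonZero t = >-nonZero (leaves>0 t)

minColless-≤-colless : ∀ t → minColless (leaves t) ≤ colless t
minColless-≤-colless leaf       = z≤n
minColless-≤-colless (node l r) = ≤-trans (minColless-≤-splitCost (leaves l) (leaves r))
  (+-mono-≤ (+-monoʳ-≤ ∣ leaves l - leaves r ∣ (minColless-≤-colless l)) (minColless-≤-colless r))

-- Divide-and-conquer trees

D-indicator≡∣-∣ : ∀ {a b} (a≟b : Dec (a ≡ b)) → ∣ a - b ∣ ≤ 1 →
                  (if does a≟b then 0 else 1) ≡ ∣ a - b ∣
D-indicator≡∣-∣ {a} (yes refl) _       = sym (∣n-n∣≡0 a)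
D-indicator≡∣-∣     (no a≢b)   ∣a-b∣≤1 = ≤-antisym (n≢0⇒n>0 (a≢b ∘ ∣m-n∣≡0⇒m≡n)) ∣a-b∣≤1

dNodes≡minColless : ∀ t → IsDivideConquer t → dNodes t ≡ minColless (leaves t)
dNodes≡minColless leaf       _                   = refl
dNodes≡minColless (node l r) (dc-l , dc-r , bal) = begin
  (if does (leaves l ≟ leaves r) then 0 else 1) + dNodes l + dNodes r
    ≡⟨ cong₂ _+_ (cong₂ _+_ (D-indicator≡∣-∣ (leaves l ≟ leaves r) bal) (dNodes≡minColless l dc-l))
                 (dNodes≡minColless r dc-r) ⟩
  splitCost (leaves l) (leaves r)
    ≡⟨ minColless-balanced (leaves l) (leaves r) {{leaves-nonZero l}} {{leaves-nonZero r}} bal ⟨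
  minColless (leaves l + leaves r) ∎
  where open ≡-Reasoning

grow : Tree → Tree
grow leaf       = node leaf leaf
grow (node l r) with leaves l ≤? leaves r
... | yes _ = node (grow l) r
... | no  _ = node l (grow r)

leaves-grow : ∀ t → leaves (grow t) ≡ suc (leaves t)
leaves-grow leaf       = refl
leaves-grow (node l r) with leaves l ≤? leaves r
... | yes _ = cong (_+ leaves r) (leaves-grow l)
... | no  _ = trans (cong (leaves l +_) (leaves-grow r)) (+-suc (leaves l) (leaves r))

grow-IsDivideConquer : ∀ t → IsDivideConquer t → IsDivideConquer (grow t)
grow-IsDivideConquer leaf       _                   = tt , tt , z≤n
grow-IsDivideConquer (node l r) (dc-l , dc-r , bal) with leaves l ≤? leaves r
... | yes l≤r = grow-IsDivideConquer l dc-l , dc-r ,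
  subst (λ a → ∣ a - leaves r ∣ ≤ 1) (sym (leaves-grow l)) (m≤n⇒∣m-n∣≤1⇒∣1+m-n∣≤1 l≤r bal)
... | no l≰r = dc-l , grow-IsDivideConquer r dc-r ,
  subst (λ b → ∣ leaves l - b ∣ ≤ 1) (sym (leaves-grow r))
    (subst (_≤ 1) (∣-∣-comm (suc (leaves r)) (leaves l))
      (m≤n⇒∣m-n∣≤1⇒∣1+m-n∣≤1 (<⇒≤ (≰⇒> l≰r)) (subst (_≤ 1) (∣-∣-comm (leaves l) (leaves r)) bal)))

divideConquer : (n : ℕ) → .{{NonZero n}} → Tree
divideConquer 1               = leaf
divideConquer (suc n@(suc _)) = grow (divideConquer n)

leaves-divideConquer : ∀ n → .{{_ : NonZero n}} → leaves (divideConquer n) ≡ n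
leaves-divideConquer 1               = refl
leaves-divideConquer (suc n@(suc _)) =
  trans (leaves-grow (divideConquer n)) (cong suc (leaves-divideConquer n))

divideConquer-IsDivideConquer : ∀ n → .{{_ : NonZero n}} → IsDivideConquer (divideConquer n)
divideConquer-IsDivideConquer 1               = tt
divideConquer-IsDivideConquer (suc n@(suc _)) =
  grow-IsDivideConquer _ (divideConquer-IsDivideConquer n)

-- Complete trees

pos-acc : ∀ a p → foldl (λ a b → 2 * a + bit b) a p ≡ a * 2 ^ length p + pos p
pos-acc a []      = sym (trans (+-identityʳ _) (*-identityʳ a))
pos-acc a (b ∷ p) = begin
  foldl (λ a b → 2 * a + bit b) (2 * a + bit b) p        ≡⟨ pos-acc (2 * a + bit b) p ⟩
  (2 * a + bit b) * 2 ^ length p + pos p                  ≡⟨ regroup a (bit b) (2 ^ length p) (pos p) ⟩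
  a * (2 * 2 ^ length p) + (bit b * 2 ^ length p + pos p)
    ≡⟨ cong (a * 2 ^ length (b ∷ p) +_) (pos-acc (bit b) p) ⟨
  a * 2 ^ length (b ∷ p) + pos (b ∷ p)                   ∎
  where
  open ≡-Reasoning
  regroup : ∀ a t c r → (2 * a + t) * c + r ≡ a * (2 * c) + (t * c + r)
  regroup = solve-∀

pos-true : ∀ p → pos (true ∷ p) ≡ 2 ^ length p + pos p
pos-true p = trans (pos-acc 1 p) (cong (_+ pos p) (*-identityˡ _))

InShape : ℕ → ℕ → List Bool → Set
InShape h m p = length p < h ⊎ (length p ≡ h × pos p < m)

HasShape : Tree → ℕ → ℕ → Set
HasShape t h m = ∀ p → HasNode t p ⇔ InShape h m p

IsComplete⇒HasShape : ∀ {t} (c : IsComplete t) → HasShape t (proj₁ c) (proj₁ (proj₂ c))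
IsComplete⇒HasShape (_ , _ , c) p = mk⇔ (proj₁ (c p)) (proj₂ (c p))

HasShape⇒IsComplete : ∀ {t h m} → HasShape t h m → IsComplete t
HasShape⇒IsComplete {h = h} {m} s = h , m , λ p → Equivalence.to (s p) , Equivalence.from (s p)

InShape-false : ∀ h m p → InShape (suc h) m (false ∷ p) ⇔ InShape h m p
InShape-false h m p = mk⇔
  (Sum.map s≤s⁻¹ (Product.map₁ suc-injective))
  (Sum.map s≤s (Product.map₁ (cong suc)))

InShape-true : ∀ h m p → InShape (suc h) m (true ∷ p) ⇔ InShape h (m ∸ 2 ^ h) p
InShape-true h m p = mk⇔
  (Sum.map s≤s⁻¹ λ { (eq , lt) → lower (suc-injective eq) lt })
  (Sum.map s≤s λ { (refl , lt) →
    refl , subst (_< m) (sym (pos-true p)) (Equivalence.from (+-<⇔<-∸ _ _ m) lt) })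
  where
  lower : length p ≡ h → pos (true ∷ p) < m → length p ≡ h × pos p < m ∸ 2 ^ h
  lower refl lt = refl , Equivalence.to (+-<⇔<-∸ _ _ m) (subst (_< m) (pos-true p) lt)

HasShape-node : ∀ {l r h m} → HasShape l h m → HasShape r h (m ∸ 2 ^ h) → HasShape (node l r) (suc h) m
HasShape-node                 _  _  []          = mk⇔ (λ _ → inj₁ z<s) (λ _ → tt)
HasShape-node {h = h} {m = m} sl _  (false ∷ p) = ⇔-sym (InShape-false h m p) ⇔-∘ sl p
HasShape-node {h = h} {m = m} _  sr (true ∷ p)  = ⇔-sym (InShape-true h m p) ⇔-∘ sr p

HasShape-children : ∀ {l r h m} → HasShape (node l r) h m →
  ∃[ h′ ] h ≡ suc h′ × HasShape l h′ m × HasShape r h′ (m ∸ 2 ^ h′)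
HasShape-children {h = zero} s with Equivalence.to (s (false ∷ [])) tt
... | inj₁ ()
... | inj₂ (() , _)
HasShape-children {h = suc h} {m} s =
  h , refl , (λ p → InShape-false h m p ⇔-∘ s (false ∷ p))
            , (λ p → InShape-true h m p ⇔-∘ s (true ∷ p))

HasShape-leaf₀ : ∀ {m} → 0 < m → HasShape leaf 0 m
HasShape-leaf₀ 0<m []      = mk⇔ (λ _ → inj₂ (refl , 0<m)) (λ _ → tt)
HasShape-leaf₀ _   (_ ∷ _) = mk⇔ (λ ()) λ { (inj₁ ()) ; (inj₂ (() , _)) }

HasShape-leaf₁ : HasShape leaf 1 0
HasShape-leaf₁ []      = mk⇔ (λ _ → inj₁ z<s) (λ _ → tt)
HasShape-leaf₁ (_ ∷ _) = mk⇔ (λ ()) λ { (inj₁ (s<s ())) ; (inj₂ (_ , ())) }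

HasShape-leaf⁻¹ : ∀ {h m} → HasShape leaf h m → (h ≡ 0 × 0 < m) ⊎ (h ≡ 1 × m ≡ 0)
HasShape-leaf⁻¹ {zero} s with Equivalence.to (s []) tt
... | inj₂ (_ , 0<m) = inj₁ (refl , 0<m)
HasShape-leaf⁻¹ {suc zero}    {zero}  _ = inj₂ (refl , refl)
HasShape-leaf⁻¹ {suc zero}    {suc m} s = ⊥-elim (Equivalence.from (s (false ∷ [])) (inj₂ (refl , z<s)))
HasShape-leaf⁻¹ {suc (suc h)}         s = ⊥-elim (Equivalence.from (s (false ∷ [])) (inj₁ (s<s z<s)))

leaves-HasShape : ∀ {t h m} → HasShape t h m → 2 * leaves t ≡ 2 ^ h + m ⊓ 2 ^ h
leaves-HasShape {leaf} s with HasShape-leaf⁻¹ s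
... | inj₁ (refl , 0<m)  = cong (1 +_) (sym (m≥n⇒m⊓n≡n 0<m))
... | inj₂ (refl , refl) = refl
leaves-HasShape {node l r} {m = m} s with HasShape-children s
... | h , refl , sl , sr = begin
  2 * (leaves l + leaves r)            ≡⟨ *-distribˡ-+ 2 (leaves l) (leaves r) ⟩
  2 * leaves l + 2 * leaves r          ≡⟨ cong₂ _+_ (leaves-HasShape sl) (leaves-HasShape sr) ⟩
  (c + m ⊓ c) + (c + (m ∸ c) ⊓ c)      ≡⟨ regroup c (m ⊓ c) ((m ∸ c) ⊓ c) ⟩
  2 * c + (m ⊓ c + (m ∸ c) ⊓ c)        ≡⟨ cong (2 * c +_) (⊓-∸-split m c) ⟩
  2 * c + m ⊓ (2 * c)                  ∎
  where
  open ≡-Reasoning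
  c = 2 ^ h
  regroup : ∀ c x y → (c + x) + (c + y) ≡ 2 * c + (x + y)
  regroup = solve-∀

-- One subtree of a complete tree is perfect, and the other has between half and twice as
-- many leaves.
minColless-complete-split : ∀ h m a b → .{{NonZero a}} → .{{NonZero b}} →
  2 * a ≡ 2 ^ h + m ⊓ 2 ^ h → 2 * b ≡ 2 ^ h + (m ∸ 2 ^ h) ⊓ 2 ^ h →
  minColless (a + b) ≡ splitCost a b
minColless-complete-split h m a b 2a≡ 2b≡ with 2 ^ h ≤? m
... | yes c≤m =
  subst (λ a → minColless (a + b) ≡ splitCost a b) (sym a≡c) (minColless-2^+ h b c≤1+2b b≤2c)
  where
  c = 2 ^ h
  2*c≡c+c : 2 * c ≡ c + c
  2*c≡c+c = cong (c +_) (+-identityʳ c)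
  a≡c : a ≡ c
  a≡c = *-cancelˡ-≡ a c 2 (trans 2a≡ (trans (cong (c +_) (m≥n⇒m⊓n≡n c≤m)) (sym 2*c≡c+c)))
  c≤1+2b : c ≤ 1 + 2 * b
  c≤1+2b = m≤n⇒m≤1+n (subst (c ≤_) (sym 2b≡) (m≤m+n c _))
  b≤2c : b ≤ 2 * c
  b≤2c = ≤-trans (*-cancelˡ-≤ 2 (subst₂ _≤_ (sym 2b≡) (sym 2*c≡c+c) (+-monoʳ-≤ c (m⊓n≤n _ c))))
                 (m≤m+n c _)
... | no c≰m with h
...   | zero  =
  ⊥-elim (even≢odd b 0 (trans 2b≡ (cong (1 +_) (cong (_⊓ 1) (m≤n⇒m∸n≡0 (<⇒≤ (≰⇒> c≰m)))))))
...   | suc j = subst (λ b → minColless (a + b) ≡ splitCost a b) (sym b≡d) (begin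
  minColless (a + d)  ≡⟨ cong minColless (+-comm a d) ⟩
  minColless (d + a)  ≡⟨ minColless-2^+ j a d≤1+2a a≤2d ⟩
  splitCost d a       ≡⟨ splitCost-comm d a ⟩
  splitCost a d       ∎)
  where
  open ≡-Reasoning
  d = 2 ^ j
  m<2d : m < 2 * d
  m<2d = ≰⇒> c≰m
  b≡d : b ≡ d
  b≡d = *-cancelˡ-≡ b d 2
    (trans 2b≡ (trans (cong (2 * d +_) (cong (_⊓ (2 * d)) (m≤n⇒m∸n≡0 (<⇒≤ m<2d)))) (+-identityʳ _)))
  2a≡2d+m : 2 * a ≡ 2 * d + m
  2a≡2d+m = trans 2a≡ (cong (2 * d +_) (m≤n⇒m⊓n≡m (<⇒≤ m<2d)))
  d≤1+2a : d ≤ 1 + 2 * a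
  d≤1+2a = m≤n⇒m≤1+n (subst (d ≤_) (sym 2a≡2d+m) (≤-trans (m≤m+n d _) (m≤m+n (2 * d) m)))
  a≤2d : a ≤ 2 * d
  a≤2d = <⇒≤ (*-cancelˡ-< 2 a (2 * d)
    (subst (_< 2 * (2 * d)) (sym 2a≡2d+m)
      (+-monoʳ-< (2 * d) (subst (m <_) (sym (+-identityʳ _)) m<2d))))

colless≡minColless : ∀ {t h m} → HasShape t h m → colless t ≡ minColless (leaves t)
colless≡minColless {leaf}     _ = refl
colless≡minColless {node l r} {m = m} s with HasShape-children s
... | h , refl , sl , sr = begin
  ∣ leaves l - leaves r ∣ + colless l + colless r
    ≡⟨ cong₂ (λ x y → ∣ leaves l - leaves r ∣ + x + y)
             (colless≡minColless sl) (colless≡minColless sr) ⟩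
  splitCost (leaves l) (leaves r)
    ≡⟨ minColless-complete-split h m (leaves l) (leaves r) {{leaves-nonZero l}} {{leaves-nonZero r}}
         (leaves-HasShape sl) (leaves-HasShape sr) ⟨
  minColless (leaves l + leaves r) ∎
  where open ≡-Reasoning

complete : ℕ → ℕ → Tree
complete zero    zero    = leaf
complete zero    (suc _) = node leaf leaf
complete (suc h) r       = node (complete h r) (complete h (r ∸ 2 ^ h))

HasShape-complete : ∀ h r → HasShape (complete h r) (suc h) (2 * r)
HasShape-complete zero    zero    = HasShape-leaf₁
HasShape-complete zero    (suc r) =
  HasShape-node (HasShape-leaf₀ z<s) (HasShape-leaf₀ (<-≤-trans z<s (m≤n+m _ r)))
HasShape-complete (suc h) r       = HasShape-node (HasShape-complete h r)
  (subst (HasShape _ (suc h)) (*-distribˡ-∸ 2 r (2 ^ h)) (HasShape-complete h (r ∸ 2 ^ h)))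

leaves-complete : ∀ h r → r ≤ 2 ^ h → leaves (complete h r) ≡ 2 ^ h + r
leaves-complete h r r≤2^h = *-cancelˡ-≡ _ _ 2 (begin
  2 * leaves (complete h r)           ≡⟨ leaves-HasShape (HasShape-complete h r) ⟩
  2 * 2 ^ h + (2 * r) ⊓ (2 * 2 ^ h)   ≡⟨ cong (2 * 2 ^ h +_) (m≤n⇒m⊓n≡m (*-monoʳ-≤ 2 r≤2^h)) ⟩
  2 * 2 ^ h + 2 * r                   ≡⟨ *-distribˡ-+ 2 (2 ^ h) r ⟨
  2 * (2 ^ h + r)                     ∎)
  where open ≡-Reasoning

theorem88 : (k r : ℕ) → r < 2 ^ k →
    (Σ Tree λ T → IsComplete T × leaves T ≡ 2 ^ k + r)
    × (Σ Tree λ D → IsDivideConquer D × leaves D ≡ 2 ^ k + r)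
    × ((T : Tree) → IsComplete T → leaves T ≡ 2 ^ k + r →
        ((T′ : Tree) → leaves T′ ≡ 2 ^ k + r → colless T ≤ colless T′)
        × ((D : Tree) → IsDivideConquer D → leaves D ≡ 2 ^ k + r →
            colless T ≡ dNodes D))
theorem88 k r r<2^k =
    (complete k r , HasShape⇒IsComplete (HasShape-complete k r) , leaves-complete k r (<⇒≤ r<2^k))
  , (divideConquer n , divideConquer-IsDivideConquer n , leaves-divideConquer n)
  , λ T T-complete T-leaves →
      let colless-T : colless T ≡ minColless n
          colless-T = trans (colless≡minColless (IsComplete⇒HasShape T-complete))
                            (cong minColless T-leaves)
      in (λ T′ T′-leaves → begin
            colless T              ≡⟨ colless-T ⟩
            minColless n           ≡⟨ cong minColless T′-leaves ⟨
            minColless (leaves T′) ≤⟨ minColless-≤-colless T′ ⟩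
            colless T′             ∎)
       , (λ D D-dc D-leaves →
            trans colless-T (trans (cong minColless (sym D-leaves)) (sym (dNodes≡minColless D D-dc))))
  where
  open ≤-Reasoning
  n = 2 ^ k + r
  instance
    n≢0 : NonZero n
    n≢0 = >-nonZero (<-≤-trans (m^n>0 2 k) (m≤m+n (2 ^ k) r))
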